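{- Let $(D,\le)$ and $(D',\le')$ be continuous domains with bases $B_D$ and $B_{D'}$, with associated triples $(B_D,\tau\circ\gamma,\mathcal{F}_D)$ and $(B_{D'},\tau'\circ\gamma',\mathcal{F}'_{D'})$, and let $\Phi$ be an approximable mapping from the first triple to the second. For $x\in D$ let $I_x=\{x'\in D' : \exists F\in\mathcal{F}_D,\ F\subseteq\{y\in B_D: y\ll x\},\ F\Phi x'\}$. Then $I_x$ has a supremum in $D'$.
   Context: Way below: $x\ll y$ iff for every directed $S$ with $y\le\bigvee S$ some $s\in S$ satisfies $x\le s$. A basis of a dcpo $D$ is $B_D\subseteq D$ such that every $x$ is the supremum of a directed subset of $\{b\in B_D:b\ll x\}$; a continuous domain is a dcpo with a basis. Associated triple of $(D,B_D)$: for $A\subseteq B_D$, $\gamma(A)=\{x\in B_D:\exists a\in A, x\le a\}$, $\tau(A)=\{x\in B_D:\exists a\in A, x\ll a\}$, $\langle A\rangle=\tau(\gamma(A))$, and $\mathcal{F}_D$ is the family of finite subsets of $B_D$ having a greatest element; similarly $\langle\cdot\rangle'$ and $\mathcal{F}'_{D'}$ for $D'$. An approximable mapping from $(X,\tau\circ\gamma,\mathcal{F})$ to $(X',\tau'\circ\gamma',\mathcal{F}')$ is a relation $\Theta\subseteq\mathcal{F}\times X'$ (for $F\in\mathcal{F}$, $S\subseteq X'$ write $F\Theta S$ if $F\Theta x'$ for all $x'\in S$) such that for all $F,F_1\in\mathcal{F}$, $F'\in\mathcal{F}'$, finite $M'\subseteq X'$: (AM1) $F\Theta F'\Rightarrow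 F\Theta\langle F'\rangle'$; (AM2) $F\subseteq\langle F_1\rangle$ and $F\Theta M'$ imply $F_1\Theta M'$; (AM3) $F\Theta M'$ implies there are $G\in\mathcal{F}$, $G'\in\mathcal{F}'$ with $G\subseteq\langle F\rangle$, $M'\subseteq\langle G'\rangle'$ and $G\Theta G'$. -}

module Defs where

open import Level using (0ℓ; Level)
open import Data.Product using (Σ; ∃; ∃-syntax; _×_; _,_)
open import Data.List using (List)
open import Data.List.Relation.Unary.All using (All)
open import Data.List.Membership.Propositional using (_∈_)
open import Relation.Unary using (Pred; _⊆_)
open import Relation.Binary.PropositionalEquality using (_≡_)
open import Relation.Binary.Structures using (IsPartialOrder)
open import Function.Bundles using (_⇔_)

record Poset : Set₁ where
  field
    Carrier : Set
    _≤_ : Carrier → Carrier → Set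
    isPartialOrder : IsPartialOrder _≡_ _≤_

module PosetNotions (P : Poset) where
  open Poset P

  Subset : Set₁
  Subset = Pred Carrier 0ℓ

  UpperBound : {ℓ : Level} → Pred Carrier ℓ → Carrier → Set ℓ
  UpperBound S u = ∀ s → S s → s ≤ u

  IsSup : {ℓ : Level} → Pred Carrier ℓ → Carrier → Set ℓ
  IsSup S u = UpperBound S u × (∀ v → UpperBound S v → u ≤ v)

  HasSup : {ℓ : Level} → Pred Carrier ℓ → Set ℓ
  HasSup S = ∃[ u ] IsSup S u

  Directed : Subset → Set
  Directed S = (∃[ s ] S s)
             × (∀ a b → S a → S b → ∃[ c ] (S c × a ≤ c × b ≤ c))

  IsDcpo : Set₁
  IsDcpo = ∀ S → Directed S → HasSup S

  _≪_ : Carrier → Carrier → Set₁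
  x ≪ y = ∀ S → Directed S → ∀ u → IsSup S u → y ≤ u → ∃[ s ] (S s × x ≤ s)

  IsBasis : Subset → Set₁
  IsBasis B = ∀ x → Σ Subset λ S →
    (∀ b → S b → B b × b ≪ x) × Directed S × IsSup S x

  module Triple (B : Subset) where
    γ : Subset → Pred Carrier (Level.suc 0ℓ)
    γ A x = Level.Lift (Level.suc 0ℓ) (B x) × ∃[ a ] (A a × Level.Lift (Level.suc 0ℓ) (x ≤ a))

    τ : Pred Carrier (Level.suc 0ℓ) → Pred Carrier (Level.suc 0ℓ)
    τ A x = Level.Lift (Level.suc 0ℓ) (B x) × ∃[ a ] (A a × x ≪ a)

    ⟨_⟩ : Subset → Pred Carrier (Level.suc 0ℓ)
    ⟨ A ⟩ = τ (γ A)

    -- finite subsets of B are represented by lists of elements of B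
    FinSub : List Carrier → Set
    FinSub F = All B F

    ⟦_⟧ : List Carrier → Subset
    ⟦ F ⟧ x = x ∈ F

    IsF : List Carrier → Set
    IsF F = FinSub F × ∃[ g ] (g ∈ F × All (λ y → y ≤ g) F)

record Approximable (D D' : Poset) (B : PosetNotions.Subset D) (B' : PosetNotions.Subset D') : Set₁ where
  private
    module N = PosetNotions D
    module N' = PosetNotions D'
    module T = N.Triple B
    module T' = N'.Triple B'
  field
    Θ : List (Poset.Carrier D) → Poset.Carrier D' → Set
    Θ-dom : ∀ {F x'} → Θ F x' → T.IsF F × B' x'
    -- Θ depends only on the set of elements of the list (lists encode finite sets)
    Θ-ext : ∀ {F G x'} → (∀ y → (y ∈ F) ⇔ (y ∈ G)) → Θ F x' → Θ G x'
    AM1 : ∀ F F' → T.IsF F → T'.IsF F' → All (Θ F) F' →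
          ∀ x' → T'.⟨ T'.⟦ F' ⟧ ⟩ x' → Θ F x'
    AM2 : ∀ F F₁ M' → T.IsF F → T.IsF F₁ → T'.FinSub M' →
          (∀ y → y ∈ F → T.⟨ T.⟦ F₁ ⟧ ⟩ y) → All (Θ F) M' → All (Θ F₁) M'
    AM3 : ∀ F M' → T.IsF F → T'.FinSub M' → All (Θ F) M' →
          Σ (List (Poset.Carrier D)) λ G → Σ (List (Poset.Carrier D')) λ G' →
            T.IsF G × T'.IsF G'
            × (∀ y → y ∈ G → T.⟨ T.⟦ F ⟧ ⟩ y)
            × (∀ y' → y' ∈ M' → T'.⟨ T'.⟦ G' ⟧ ⟩ y')
            × All (Θ G) G'

I : {D D' : Poset} {B : PosetNotions.Subset D} {B' : PosetNotions.Subset D'} →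
    Approximable D D' B B' → Poset.Carrier D → Poset.Carrier D' → Set₁
I {D} {D'} {B} {B'} Φ x x' =
  ∃[ F ] (PosetNotions.Triple.IsF D B F
         × All (λ y → B y × PosetNotions._≪_ D y x) F
         × Approximable.Θ Φ F x')

module Submission where

-- Fix a directed set S_x ⊆ {b ∈ B | b ≪ x} with ⋁ S_x = x (basis).
-- (1) Φ is monotone on singletons: if F Φ x' and the greatest element of F
--     lies below s ∈ B, then [s] Φ x'  (AM3, then AM1, then AM2).
-- (2) Every finite M' with F Φ M' has an upper bound g' with G Φ g' for some
--     G ∈ 𝓕, G ⊆ ⟨F⟩  (AM3 plus AM1 on the greatest element of G').
-- Using (1) and the way-below relation g ≪ x ≤ ⋁ S_x, the set I_x coincides
-- with J = { x' | ∃ s ∈ S_x, [s] Φ x' }, which is a small predicate.  J is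
-- directed: S_x is directed, (1) moves two witnesses to a common s ∈ S_x, and
-- (2) with F = [s] yields an element of I_x above both.  The dcpo D' gives a
-- supremum of J, which is then a supremum of I_x.

open import Defs
open import Level using (lift)
open import Data.Product using (Σ; ∃-syntax; _×_; _,_; proj₁; proj₂)
open import Data.List using (List; []; _∷_; [_])
open import Data.List.Relation.Unary.All using (All; []; _∷_; lookup; tabulate)
open import Data.List.Relation.Unary.Any using (here)
open import Data.List.Membership.Propositional using (_∈_)
open import Relation.Unary using (Pred)
open import Relation.Binary.PropositionalEquality using (_≡_; refl)
open import Relation.Binary.Structures using (IsPartialOrder)

module OrderFacts (P : Poset) where
  open Poset P
  open PosetNotions P
  open IsPartialOrder isPartialOrder public using () renaming (refl to ≤-refl; trans to ≤-trans)

  -- Way-below implies below: test y ≪ z against the directed set {z}.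
  ≪⇒≤ : ∀ {y z} → y ≪ z → y ≤ z
  ≪⇒≤ {y} {z} y≪z with y≪z (_≡ z) singleton-directed z singleton-sup ≤-refl
    where
    singleton-directed : Directed (_≡ z)
    singleton-directed = (z , refl) , λ { _ _ refl refl → z , refl , ≤-refl , ≤-refl }
    singleton-sup : IsSup (_≡ z) z
    singleton-sup = (λ { _ refl → ≤-refl }) , λ v ub → ub z refl
  ... | _ , refl , y≤z = y≤z

  ≤-≪-trans : ∀ {y z w} → y ≤ z → z ≪ w → y ≪ w
  ≤-≪-trans y≤z z≪w S dir u sup w≤u with z≪w S dir u sup w≤u
  ... | s , s∈S , z≤s = s , s∈S , ≤-trans y≤z z≤s

  IsSup-transfer : ∀ {ℓ ℓ′} {S : Pred Carrier ℓ} {T : Pred Carrier ℓ′} {u} →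
                   (∀ {z} → S z → T z) → (∀ {z} → T z → S z) →
                   IsSup T u → IsSup S u
  IsSup-transfer S⊆T T⊆S (ub , least) =
    (λ s Ss → ub s (S⊆T Ss)) , (λ v ubv → least v (λ t Tt → ubv t (T⊆S Tt)))

  module _ (B : Subset) where
    open Triple B

    ⟨⟩-below : ∀ {F g y} → All (_≤ g) F → ⟨ ⟦ F ⟧ ⟩ y → y ≤ g
    ⟨⟩-below F≤g (_ , a , (_ , f , f∈F , lift a≤f) , y≪a) =
      ≤-trans (≪⇒≤ y≪a) (≤-trans a≤f (lookup F≤g f∈F))

    ⟨⟩-into-singleton : ∀ {F s y} → B s → All (_≤ s) F → ⟨ ⟦ F ⟧ ⟩ y → ⟨ ⟦ [ s ] ⟧ ⟩ y
    ⟨⟩-into-singleton Bs F≤s (By , a , (Ba , f , f∈F , lift a≤f) , y≪a) =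
      By , a , (Ba , _ , here refl , lift (≤-trans a≤f (lookup F≤s f∈F))) , y≪a

    singleton-IsF : ∀ {s} → B s → IsF [ s ]
    singleton-IsF Bs = (Bs ∷ []) , _ , here refl , (≤-refl ∷ [])

module ApproximableFacts {D D' : Poset} {B : PosetNotions.Subset D}
    {B' : PosetNotions.Subset D'} (Φ : Approximable D D' B B') where
  open Poset D using (_≤_)
  open Poset D' using () renaming (_≤_ to _≤'_)
  open PosetNotions.Triple D B
  open OrderFacts D
  module O' = OrderFacts D'
  open Approximable Φ

  Θ-upper-bound : ∀ {F M'} → IsF F → All B' M' → All (Θ F) M' →
                  Σ (List (Poset.Carrier D)) λ G → ∃[ g' ]
                    (IsF G × (∀ y → y ∈ G → ⟨ ⟦ F ⟧ ⟩ y) × Θ G g' × All (_≤' g') M')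
  Θ-upper-bound {F} {M'} fF BM' ΘM'
    with AM3 F M' fF BM' ΘM'
  ... | G , G' , fG , (_ , g' , g'∈G' , G'≤g') , G⊆⟨F⟩ , M'⊆⟨G'⟩ , ΘG' =
    G , g' , fG , G⊆⟨F⟩ , lookup ΘG' g'∈G' ,
    tabulate (λ m∈M' → O'.⟨⟩-below B' G'≤g' (M'⊆⟨G'⟩ _ m∈M'))

  Θ-mono : ∀ {F x' g s} → IsF F → All (_≤ g) F → g ≤ s → B s →
           Θ F x' → Θ [ s ] x'
  Θ-mono {F} {x'} {g} {s} fF F≤g g≤s Bs θ
    with AM3 F [ x' ] fF (B'x' ∷ []) (θ ∷ [])
    where B'x' = proj₂ (Θ-dom θ)
  ... | G , G' , fG , fG' , G⊆⟨F⟩ , x'∈⟨G'⟩ , ΘG' =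
    lookup (AM2 G [ s ] [ x' ] fG (singleton-IsF B Bs) (proj₂ (Θ-dom θ) ∷ [])
              G⊆⟨[s]⟩ (Θx' ∷ []))
           (here refl)
    where
    Θx' : Θ G x'
    Θx' = AM1 G G' fG fG' ΘG' x' (x'∈⟨G'⟩ x' (here refl))
    G⊆⟨[s]⟩ : ∀ y → y ∈ G → ⟨ ⟦ [ s ] ⟧ ⟩ y
    G⊆⟨[s]⟩ y y∈G = ⟨⟩-into-singleton B Bs
      (tabulate (λ f∈F → ≤-trans (lookup F≤g f∈F) g≤s)) (G⊆⟨F⟩ y y∈G)

module ImageOfPoint (D D' : Poset) (B : PosetNotions.Subset D)
    (basis : PosetNotions.IsBasis D B) (B' : PosetNotions.Subset D')
    (Φ : Approximable D D' B B') (x : Poset.Carrier D) where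
  open PosetNotions D
  open Triple B
  open OrderFacts D
  module N' = PosetNotions D'
  open Poset D' using () renaming (_≤_ to _≤'_)
  open Approximable Φ
  open ApproximableFacts Φ

  Sₓ : Subset
  Sₓ = proj₁ (basis x)

  Sₓ-approx : ∀ {s} → Sₓ s → B s × s ≪ x
  Sₓ-approx = proj₁ (proj₂ (basis x)) _

  Sₓ-directed : Directed Sₓ
  Sₓ-directed = proj₁ (proj₂ (proj₂ (basis x)))

  Sₓ-sup : IsSup Sₓ x
  Sₓ-sup = proj₂ (proj₂ (proj₂ (basis x)))

  J : N'.Subset
  J x' = ∃[ s ] (Sₓ s × Θ [ s ] x')

  -- The greatest element of F is way below x, hence below some s ∈ Sₓ.
  I⊆J : ∀ {x'} → I Φ x x' → J x'
  I⊆J (F , fF@(_ , g , g∈F , F≤g) , F≪x , θ)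
    with proj₂ (lookup F≪x g∈F) Sₓ Sₓ-directed x Sₓ-sup ≤-refl
  ... | s , s∈Sₓ , g≤s = s , s∈Sₓ , Θ-mono fF F≤g g≤s (proj₁ (Sₓ-approx s∈Sₓ)) θ

  J⊆I : ∀ {x'} → J x' → I Φ x x'
  J⊆I (s , s∈Sₓ , θ) = [ s ] , singleton-IsF B (proj₁ (Sₓ-approx s∈Sₓ)) , (Sₓ-approx s∈Sₓ ∷ []) , θ

  bound-in-I : ∀ {s M'} → Sₓ s → All B' M' → All (Θ [ s ]) M' →
               ∃[ c ] (I Φ x c × All (_≤' c) M')
  bound-in-I {s} s∈Sₓ BM' ΘM'
    with Θ-upper-bound (singleton-IsF B (proj₁ (Sₓ-approx s∈Sₓ))) BM' ΘM'
  ... | G , g' , fG@(BG , _) , G⊆⟨[s]⟩ , θ , M'≤g' =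
    g' , (G , fG , tabulate G-approx , θ) , M'≤g'
    where
    G-approx : ∀ {y} → y ∈ G → B y × y ≪ x
    G-approx y∈G = lookup BG y∈G ,
      ≤-≪-trans (⟨⟩-below B (≤-refl ∷ []) (G⊆⟨[s]⟩ _ y∈G)) (proj₂ (Sₓ-approx s∈Sₓ))

  J-directed : N'.Directed J
  J-directed = inhabited , pairwise-bounded
    where
    inhabited : ∃[ c ] J c
    inhabited with proj₁ Sₓ-directed
    ... | s , s∈Sₓ with bound-in-I s∈Sₓ [] []
    ... | c , c∈I , _ = c , I⊆J c∈I

    -- Move both witnesses to a common s₃ ∈ Sₓ, then bound them inside I_x.
    pairwise-bounded : ∀ a b → J a → J b → ∃[ c ] (J c × a ≤' c × b ≤' c)
    pairwise-bounded a b (s₁ , s₁∈Sₓ , θa) (s₂ , s₂∈Sₓ , θb)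
      with proj₂ Sₓ-directed s₁ s₂ s₁∈Sₓ s₂∈Sₓ
    ... | s₃ , s₃∈Sₓ , s₁≤s₃ , s₂≤s₃
      with bound-in-I s₃∈Sₓ (proj₂ (Θ-dom θa') ∷ proj₂ (Θ-dom θb') ∷ []) (θa' ∷ θb' ∷ [])
      where
      Bs₃ = proj₁ (Sₓ-approx s₃∈Sₓ)
      θa' = Θ-mono (singleton-IsF B (proj₁ (Sₓ-approx s₁∈Sₓ))) (≤-refl ∷ []) s₁≤s₃ Bs₃ θa
      θb' = Θ-mono (singleton-IsF B (proj₁ (Sₓ-approx s₂∈Sₓ))) (≤-refl ∷ []) s₂≤s₃ Bs₃ θb
    ... | c , c∈I , a≤c ∷ b≤c ∷ [] = c , I⊆J c∈I , a≤c , b≤c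

lemma4p5 : (D D' : Poset) → PosetNotions.IsDcpo D → PosetNotions.IsDcpo D' →
    (B : PosetNotions.Subset D) → PosetNotions.IsBasis D B →
    (B' : PosetNotions.Subset D') → PosetNotions.IsBasis D' B' →
    (Φ : Approximable D D' B B') → (x : Poset.Carrier D) →
    PosetNotions.HasSup D' (λ x' → I Φ x x')
lemma4p5 D D' _ dcpo' B basis B' _ Φ x =
  let (u , u-sup) = dcpo' J J-directed in u , IsSup-transfer I⊆J J⊆I u-sup
  where
  open ImageOfPoint D D' B basis B' Φ x
  open OrderFacts D' using (IsSup-transfer)
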